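{- For $n\ge1$ let $S_n(132)$ be the set of $132$-avoiding permutations of $\{1,\dots,n\}$, and for $\sigma=\sigma_1\cdots\sigma_n$ let $\mathrm{box}(\sigma)$ be the number of indices $i$ such that $|\sigma_i-\sigma_{i+1}|=1$ or $|\sigma_{i-1}-\sigma_i|=1$ (ignoring nonexistent entries). Let $A_n(x)=\sum_{\sigma\in S_n(132)}x^{\mathrm{box}(\sigma)}$, $B_n(x)=\sum_{\sigma\in S_n(132),\sigma_1=n}x^{\mathrm{box}(\sigma)}$, $E_n(x)=\sum_{\sigma\in S_n(132),\sigma_n=n}x^{\mathrm{box}(\sigma)}$. Then for $n\ge2$, $A_n(x)|_{x^2}=F_n$ and $B_n(x)|_{x^2}=E_n(x)|_{x^2}=F_{n-2}$.
   Context: A permutation $\sigma\in S_n$ avoids $132$ if there are no indices $i<j<k$ with $\sigma_i<\sigma_k<\sigma_j$. $P(x)|_{x^m}$ denotes the coefficient of $x^m$ in the polynomial $P(x)$. The Fibonacci numbers are defined by $F_0=F_1=1$ and $F_n=F_{n-1}+F_{n-2}$ for $n\ge2$. -}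

module Defs where

open import Data.Nat using (ℕ; zero; suc; _+_; _<ᵇ_; _≡ᵇ_)
open import Data.Bool using (Bool; true; false; _∧_; _∨_; if_then_else_; not)
open import Data.List using (List; []; _∷_; [_]; map; concatMap; filter; foldr; replicate; _++_; reverse)
open import Data.Bool.ListAction using (any)
open import Data.Maybe using (Maybe; just; nothing)
open import Function using (_∘_)
import Data.Bool

F : ℕ → ℕ
F zero = 1
F (suc zero) = 1
F (suc (suc n)) = F (suc n) + F n

oneTo : ℕ → List ℕ
oneTo zero = []
oneTo (suc n) = oneTo n ++ [ suc n ]

insertAll : ℕ → List ℕ → List (List ℕ)
insertAll x [] = [ x ∷ [] ]
insertAll x (y ∷ ys) = (x ∷ y ∷ ys) ∷ map (y ∷_) (insertAll x ys)

perms : ℕ → List (List ℕ)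
perms zero = [ [] ]
perms (suc n) = concatMap (insertAll (suc n)) (perms n)

pairAfter : ℕ → List ℕ → Bool
pairAfter a [] = false
pairAfter a (b ∷ rest) = any (λ c → (a <ᵇ c) ∧ (c <ᵇ b)) rest ∨ pairAfter a rest

has132 : List ℕ → Bool
has132 [] = false
has132 (a ∷ rest) = pairAfter a rest ∨ has132 rest

avoids132 : List ℕ → Bool
avoids132 σ = not (has132 σ)

adj : ℕ → ℕ → Bool
adj a b = (a ≡ᵇ suc b) ∨ (b ≡ᵇ suc a)

adjM : Maybe ℕ → ℕ → Bool
adjM nothing a = false
adjM (just b) a = adj b a

headM : List ℕ → Maybe ℕ
headM [] = nothing
headM (x ∷ _) = just x

boxAux : Maybe ℕ → List ℕ → ℕ
boxAux p [] = 0
boxAux p (a ∷ rest) =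
  (if adjM p a ∨ adjM (headM rest) a then 1 else 0) + boxAux (just a) rest

box : List ℕ → ℕ
box = boxAux nothing

-- polynomials with natural coefficients, as coefficient lists (constant term first)
Poly : Set
Poly = List ℕ

_⊕_ : Poly → Poly → Poly
[] ⊕ q = q
(a ∷ p) ⊕ [] = a ∷ p
(a ∷ p) ⊕ (b ∷ q) = (a + b) ∷ (p ⊕ q)

xPow : ℕ → Poly
xPow k = replicate k 0 ++ [ 1 ]

coeff : Poly → ℕ → ℕ
coeff [] m = 0
coeff (a ∷ p) zero = a
coeff (a ∷ p) (suc m) = coeff p m

boxPoly : List (List ℕ) → Poly
boxPoly L = foldr (λ σ p → xPow (box σ) ⊕ p) [] L

S132 : ℕ → List (List ℕ)
S132 n = filter (λ σ → Data.Bool.T? (avoids132 σ)) (perms n)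

firstIs : ℕ → List ℕ → Bool
firstIs n [] = false
firstIs n (x ∷ _) = x ≡ᵇ n

lastIs : ℕ → List ℕ → Bool
lastIs n σ = firstIs n (reverse σ)

A : ℕ → Poly
A n = boxPoly (S132 n)

B : ℕ → Poly
B n = boxPoly (filter (λ σ → Data.Bool.T? (firstIs n σ)) (S132 n))

E : ℕ → Poly
E n = boxPoly (filter (λ σ → Data.Bool.T? (lastIs n σ)) (S132 n))

module Submission where

-- A permutation has box value 2 exactly when it has exactly one adjacent pair |σᵢ − σᵢ₊₁| = 1;
-- call such 132-avoiders good. A 132-avoider is α (n+1) β with α above β, and in it every factor
-- of length ≥ 2 whose entries form an interval of values contains an adjacent pair. Hence in a good
-- avoider of length n+1 ≥ 3 the maximum is first, last, or second to last followed by the minimum: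
-- anywhere else it leaves two adjacent pairs. Deleting the maximum (and in the last case the minimum)
-- gives B(n+1) = A(n) − B(n), E(n+1) = A(n) − E(n) and A(n+1) = B(n+1) + E(n+1) + E(n).

open import Defs
open import Algebra.Bundles using (CommutativeMonoid)
open import Data.Bool using (Bool; true; false; _∧_; _∨_; not; if_then_else_; T?)
open import Data.Bool.ListAction using (any)
open import Data.Bool.Properties
  using (∨-commutativeMonoid; ∨-comm; ∨-assoc; ∨-identityʳ; ∨-zeroʳ; ∧-identityʳ; ∧-zeroʳ)
open import Data.Empty using (⊥; ⊥-elim)
open import Data.List using (List; []; _∷_; _++_; map; concatMap; filter; reverse; length)
open import Data.List.Membership.Propositional using (_∈_)
open import Data.List.Membership.Propositional.Properties using (∈-++⁺ʳ)
open import Data.List.Properties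
  using (∷-injective; ++-assoc; ++-identityʳ; length-++; map-∘; map-++; reverse-++; reverse-map)
open import Data.List.Relation.Unary.All as All using (All; []; _∷_; lookup)
open import Data.List.Relation.Unary.All.Properties using (++⁺; ++⁻; ++⁻ˡ; ++⁻ʳ; map⁺)
open import Data.List.Relation.Unary.Any using (here; there)
open import Data.List.Reverse using (reverseView; []; _∶_∶ʳ_)
open import Data.Maybe as Maybe using (Maybe; just; nothing)
open import Data.Nat using (ℕ; zero; suc; _+_; _*_; _≤_; _<_; _∸_; z≤n; s≤s; _<ᵇ_; _≡ᵇ_)
open import Data.Nat.Properties
open import Data.Product using (_×_; _,_; Σ; proj₁; proj₂)
open import Data.Sum using (_⊎_; inj₁; inj₂)
open import Relation.Binary.PropositionalEquality
open import Algebra.Properties.CommutativeSemigroup +-commutativeSemigroup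
  using () renaming (interchange to +-interchange)
open import Algebra.Properties.CommutativeSemigroup *-commutativeSemigroup
  using () renaming (x∙yz≈y∙xz to *-left-comm)
open import Algebra.Properties.CommutativeSemigroup (CommutativeMonoid.commutativeSemigroup ∨-commutativeMonoid)
  using () renaming (interchange to ∨-interchange)

𝟙 : Bool → ℕ
𝟙 true = 1
𝟙 false = 0

𝟙-∧ : ∀ p q → 𝟙 (p ∧ q) ≡ 𝟙 p * 𝟙 q
𝟙-∧ true q = sym (+-identityʳ (𝟙 q))
𝟙-∧ false q = refl

if-then-1-else-0 : ∀ b → (if b then 1 else 0) ≡ 𝟙 b
if-then-1-else-0 true = refl
if-then-1-else-0 false = refl

sumBy : {A : Set} → (A → ℕ) → List A → ℕ
sumBy f [] = 0
sumBy f (x ∷ xs) = f x + sumBy f xs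

module _ {A : Set} where

  sumBy-cong-All : ∀ {P : A → Set} {f g : A → ℕ} xs → All P xs →
    (∀ x → P x → f x ≡ g x) → sumBy f xs ≡ sumBy g xs
  sumBy-cong-All [] [] e = refl
  sumBy-cong-All (x ∷ xs) (px ∷ pxs) e = cong₂ _+_ (e x px) (sumBy-cong-All xs pxs e)

  sumBy-cong : ∀ {f g : A → ℕ} xs → (∀ x → f x ≡ g x) → sumBy f xs ≡ sumBy g xs
  sumBy-cong [] e = refl
  sumBy-cong (x ∷ xs) e = cong₂ _+_ (e x) (sumBy-cong xs e)

  sumBy-zero : ∀ (f : A → ℕ) xs → (∀ x → f x ≡ 0) → sumBy f xs ≡ 0
  sumBy-zero f [] e = refl
  sumBy-zero f (x ∷ xs) e rewrite e x = sumBy-zero f xs e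

  sumBy-++ : ∀ (f : A → ℕ) xs ys → sumBy f (xs ++ ys) ≡ sumBy f xs + sumBy f ys
  sumBy-++ f [] ys = refl
  sumBy-++ f (x ∷ xs) ys = trans (cong (f x +_) (sumBy-++ f xs ys)) (sym (+-assoc (f x) _ _))

  sumBy-+ : ∀ (f g : A → ℕ) xs → sumBy (λ x → f x + g x) xs ≡ sumBy f xs + sumBy g xs
  sumBy-+ f g [] = refl
  sumBy-+ f g (x ∷ xs) =
    trans (cong (f x + g x +_) (sumBy-+ f g xs)) (+-interchange (f x) (g x) (sumBy f xs) (sumBy g xs))

  sumBy-* : ∀ c (f : A → ℕ) xs → sumBy (λ x → c * f x) xs ≡ c * sumBy f xs
  sumBy-* c f [] = sym (*-zeroʳ c)
  sumBy-* c f (x ∷ xs) = trans (cong (c * f x +_) (sumBy-* c f xs)) (sym (*-distribˡ-+ c (f x) _))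

  sumBy-filter : ∀ (P : A → Bool) (f : A → ℕ) xs →
    sumBy f (filter (λ x → T? (P x)) xs) ≡ sumBy (λ x → 𝟙 (P x) * f x) xs
  sumBy-filter P f [] = refl
  sumBy-filter P f (x ∷ xs) with P x
  ... | true = cong₂ _+_ (sym (+-identityʳ (f x))) (sumBy-filter P f xs)
  ... | false = sumBy-filter P f xs

module _ {A B : Set} where

  sumBy-map : ∀ (f : B → ℕ) (g : A → B) xs → sumBy f (map g xs) ≡ sumBy (λ x → f (g x)) xs
  sumBy-map f g [] = refl
  sumBy-map f g (x ∷ xs) = cong (f (g x) +_) (sumBy-map f g xs)

  sumBy-concatMap : ∀ (f : B → ℕ) (g : A → List B) xs →
    sumBy f (concatMap g xs) ≡ sumBy (λ x → sumBy f (g x)) xs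
  sumBy-concatMap f g [] = refl
  sumBy-concatMap f g (x ∷ xs) =
    trans (sumBy-++ f (g x) (concatMap g xs)) (cong (sumBy f (g x) +_) (sumBy-concatMap f g xs))

-- Box value and adjacent pairs

adjPairsFrom : Maybe ℕ → List ℕ → ℕ
adjPairsFrom p [] = 0
adjPairsFrom p (a ∷ rest) = 𝟙 (adjM p a) + adjPairsFrom (just a) rest

adjPairs : List ℕ → ℕ
adjPairs = adjPairsFrom nothing

startsAdjacent : Maybe ℕ → List ℕ → Bool
startsAdjacent p [] = false
startsAdjacent p (a ∷ _) = adjM p a

adj-sym : ∀ a b → adj a b ≡ adj b a
adj-sym a b with a ≡ᵇ suc b | b ≡ᵇ suc a
... | true | true = refl
... | true | false = refl
... | false | true = refl
... | false | false = refl

-- How the number p of adjacent pairs of a word constrains its box value b; c = 1 records that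
-- the first entry is adjacent to the predecessor outside the word, which box counts elsewhere.
BoxProfile : ℕ → ℕ → ℕ → Set
BoxProfile p b c = (p ≡ 0 → b ≡ 0) × (p ≡ 1 → b + c ≡ 2) × (2 ≤ p → 3 ≤ b + c)

boxProfile-cons : ∀ f g p b → BoxProfile p b (𝟙 g) → 𝟙 g ≤ p →
  BoxProfile (𝟙 f + p) (𝟙 (f ∨ g) + b) (𝟙 f)
boxProfile-cons f false zero b (t0 , _ , _) _ with t0 refl
... | refl with f
...   | false = (λ _ → refl) , (λ ()) , (λ ())
...   | true = (λ ()) , (λ _ → refl) , (λ { (s≤s ()) })
boxProfile-cons f true zero b _ ()
boxProfile-cons false g 1 b (_ , t1 , _) _ =
  (λ ()) , (λ _ → trans (+-identityʳ _) (trans (+-comm (𝟙 g) b) (t1 refl))) , (λ { (s≤s ()) })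
boxProfile-cons true g 1 b (_ , t1 , _) _ =
  (λ ()) , (λ ()) , (λ _ → s≤s (+-monoˡ-≤ 1 (positive g b (≤-reflexive (sym (t1 refl))))))
  where
  positive : ∀ g b → 2 ≤ b + 𝟙 g → 1 ≤ b
  positive g (suc b) _ = s≤s z≤n
  positive true zero (s≤s ())
  positive false zero ()
boxProfile-cons false g (suc (suc p)) b (_ , _ , t2) _ =
  (λ ()) , (λ ()) , (λ _ → subst (3 ≤_) (trans (+-comm b (𝟙 g)) (sym (+-identityʳ _))) (t2 (s≤s (s≤s z≤n))))
boxProfile-cons true g (suc (suc p)) b (_ , _ , t2) _ =
  (λ ()) , (λ ()) , (λ _ → s≤s (+-monoˡ-≤ 1 (positive g b (t2 (s≤s (s≤s z≤n))))))
  where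
  positive : ∀ g b → 3 ≤ b + 𝟙 g → 1 ≤ b
  positive g (suc b) _ = s≤s z≤n
  positive true zero (s≤s ())
  positive false zero ()

boxProfile : ∀ p l → BoxProfile (adjPairsFrom p l) (boxAux p l) (𝟙 (startsAdjacent p l))
boxProfile p [] = (λ _ → refl) , (λ ()) , (λ ())
boxProfile p (a ∷ rest) =
  subst (λ b → BoxProfile (adjPairsFrom p (a ∷ rest)) b (𝟙 (adjM p a)))
    (cong (_+ boxAux (just a) rest)
      (sym (trans (if-then-1-else-0 _) (cong (λ g → 𝟙 (adjM p a ∨ g)) (nextAdjacent rest)))))
    (boxProfile-cons (adjM p a) (startsAdjacent (just a) rest) _ _
      (boxProfile (just a) rest) (first≤adjPairs rest))
  where
  nextAdjacent : ∀ rest → adjM (headM rest) a ≡ startsAdjacent (just a) rest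
  nextAdjacent [] = refl
  nextAdjacent (b ∷ _) = adj-sym b a
  first≤adjPairs : ∀ rest → 𝟙 (startsAdjacent (just a) rest) ≤ adjPairsFrom (just a) rest
  first≤adjPairs [] = z≤n
  first≤adjPairs (b ∷ _) = m≤m+n _ _

box≡ᵇ2 : ∀ σ → (box σ ≡ᵇ 2) ≡ (adjPairs σ ≡ᵇ 1)
box≡ᵇ2 σ = fromProfile (adjPairs σ) (box σ) (subst (BoxProfile _ _) (noPredecessor σ) (boxProfile nothing σ))
  where
  noPredecessor : ∀ σ → 𝟙 (startsAdjacent nothing σ) ≡ 0
  noPredecessor [] = refl
  noPredecessor (_ ∷ _) = refl
  fromProfile : ∀ p b → BoxProfile p b 0 → (b ≡ᵇ 2) ≡ (p ≡ᵇ 1)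
  fromProfile zero b (t0 , _ , _) rewrite t0 refl = refl
  fromProfile 1 b (_ , t1 , _) = cong (_≡ᵇ 2) (trans (sym (+-identityʳ b)) (t1 refl))
  fromProfile (suc (suc p)) b (_ , _ , t2) = ≥3⇒≢ᵇ2 (subst (3 ≤_) (+-identityʳ b) (t2 (s≤s (s≤s z≤n))))
    where
    ≥3⇒≢ᵇ2 : ∀ {b} → 3 ≤ b → (b ≡ᵇ 2) ≡ false
    ≥3⇒≢ᵇ2 (s≤s (s≤s (s≤s _))) = refl

≤⇒<ᵇ≡false : ∀ {u v} → v ≤ u → (u <ᵇ v) ≡ false
≤⇒<ᵇ≡false {u} {zero} z≤n = refl
≤⇒<ᵇ≡false {suc u} {suc v} (s≤s p) = ≤⇒<ᵇ≡false p

<⇒<ᵇ≡true : ∀ {u v} → u < v → (u <ᵇ v) ≡ true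
<⇒<ᵇ≡true {zero} {suc v} _ = refl
<⇒<ᵇ≡true {suc u} {suc v} (s≤s p) = <⇒<ᵇ≡true p

<ᵇ≡false⇒≤ : ∀ u v → (u <ᵇ v) ≡ false → v ≤ u
<ᵇ≡false⇒≤ u zero _ = z≤n
<ᵇ≡false⇒≤ (suc u) (suc v) e = s≤s (<ᵇ≡false⇒≤ u v e)

≡ᵇ-refl : ∀ n → (n ≡ᵇ n) ≡ true
≡ᵇ-refl zero = refl
≡ᵇ-refl (suc n) = ≡ᵇ-refl n

≡ᵇ-sym : ∀ m n → (m ≡ᵇ n) ≡ (n ≡ᵇ m)
≡ᵇ-sym zero zero = refl
≡ᵇ-sym zero (suc n) = refl
≡ᵇ-sym (suc m) zero = refl
≡ᵇ-sym (suc m) (suc n) = ≡ᵇ-sym m n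

<⇒≡ᵇ≡false : ∀ {l n} → l < n → (l ≡ᵇ n) ≡ false
<⇒≡ᵇ≡false {zero} {suc n} _ = refl
<⇒≡ᵇ≡false {suc l} {suc n} (s≤s p) = <⇒≡ᵇ≡false p

adj-suc : ∀ {l n} → l ≤ n → adj l (suc n) ≡ (l ≡ᵇ n)
adj-suc {l} {n} l≤n rewrite <⇒≡ᵇ≡false {l} {suc (suc n)} (s≤s (m≤n⇒m≤1+n l≤n)) = ≡ᵇ-sym n l

adj-sucˡ : ∀ {l n} → l ≤ n → adj (suc n) l ≡ (l ≡ᵇ n)
adj-sucˡ {l} {n} l≤n = trans (adj-sym (suc n) l) (adj-suc l≤n)

adj-n-1+n : ∀ n → adj n (suc n) ≡ true
adj-n-1+n n = trans (adj-suc (≤-refl {n})) (≡ᵇ-refl n)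

any-++ : ∀ (p : ℕ → Bool) xs ys → any p (xs ++ ys) ≡ any p xs ∨ any p ys
any-++ p [] ys = refl
any-++ p (x ∷ xs) ys = trans (cong (p x ∨_) (any-++ p xs ys)) (sym (∨-assoc (p x) _ _))

any-map : ∀ (p : ℕ → Bool) (f : ℕ → ℕ) xs → any p (map f xs) ≡ any (λ x → p (f x)) xs
any-map p f [] = refl
any-map p f (x ∷ xs) = cong (p (f x) ∨_) (any-map p f xs)

any-cong-All : ∀ {p q : ℕ → Bool} xs → All (λ x → p x ≡ q x) xs → any p xs ≡ any q xs
any-cong-All [] [] = refl
any-cong-All (x ∷ xs) (e ∷ es) = cong₂ _∨_ e (any-cong-All xs es)

All⇒any≡false : ∀ {p : ℕ → Bool} xs → All (λ x → p x ≡ false) xs → any p xs ≡ false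
All⇒any≡false [] [] = refl
All⇒any≡false (x ∷ xs) (e ∷ es) rewrite e = All⇒any≡false xs es

any≡false⇒All : ∀ {p : ℕ → Bool} xs → any p xs ≡ false → All (λ x → p x ≡ false) xs
any≡false⇒All [] _ = []
any≡false⇒All {p} (x ∷ xs) e with p x in px
... | false = px ∷ any≡false⇒All xs e

rises : List ℕ → List ℕ → Bool
rises a b = any (λ u → any (λ v → u <ᵇ v) b) a

Above : List ℕ → List ℕ → Set
Above a b = All (λ u → All (_≤ u) b) a

rises≡false⇒Above : ∀ a b → rises a b ≡ false → Above a b
rises≡false⇒Above a b e =
  All.map (λ {u} e′ → All.map (<ᵇ≡false⇒≤ u _) (any≡false⇒All b e′)) (any≡false⇒All a e)

Above⇒rises≡false : ∀ a b → Above a b → rises a b ≡ false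
Above⇒rises≡false a b above =
  All⇒any≡false a (All.map (λ u≥b → All⇒any≡false b (All.map ≤⇒<ᵇ≡false u≥b)) above)

rises-++ˡ : ∀ a b r → rises (a ++ b) r ≡ rises a r ∨ rises b r
rises-++ˡ a b r = any-++ (λ u → any (λ v → u <ᵇ v) r) a b

Above-[] : ∀ a → Above a []
Above-[] = All.universal (λ _ → [])

rises-[] : ∀ a → rises a [] ≡ false
rises-[] a = Above⇒rises≡false a [] (Above-[] a)

Above-remove : ∀ a w b r → Above (a ++ w ∷ b) r → Above (a ++ b) r
Above-remove a w b r above with ++⁻ a above
... | above-a , (_ ∷ above-b) = ++⁺ above-a above-b

-- 132-patterns under insertion of a maximum

pairAfter-below : ∀ x b → All (_< x) b → pairAfter x b ≡ false
pairAfter-below x [] [] = refl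
pairAfter-below x (c ∷ r) (c<x ∷ r<x)
  rewrite All⇒any≡false {λ d → (x <ᵇ d) ∧ (d <ᵇ c)} r
            (All.map (λ {d} d<x → cong (_∧ (d <ᵇ c)) (≤⇒<ᵇ≡false (<⇒≤ d<x))) r<x)
  = pairAfter-below x r r<x

pairAfter-insertMax : ∀ u x a b → All (_< x) a → All (_< x) b →
  pairAfter u (a ++ x ∷ b) ≡ pairAfter u (a ++ b) ∨ any (u <ᵇ_) b
pairAfter-insertMax u x [] b _ b<x =
  trans (cong (_∨ pairAfter u b) (any-cong-All b (All.map dropBound b<x))) (∨-comm (any (u <ᵇ_) b) (pairAfter u b))
  where
  dropBound : ∀ {c} → c < x → ((u <ᵇ c) ∧ (c <ᵇ x)) ≡ (u <ᵇ c)
  dropBound {c} c<x = trans (cong ((u <ᵇ c) ∧_) (<⇒<ᵇ≡true c<x)) (∧-identityʳ (u <ᵇ c))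
pairAfter-insertMax u x (w ∷ a) b (w<x ∷ a<x) b<x = begin
    any P (a ++ x ∷ b) ∨ pairAfter u (a ++ x ∷ b)
  ≡⟨ cong₂ _∨_ skipMax (pairAfter-insertMax u x a b a<x b<x) ⟩
    any P (a ++ b) ∨ (pairAfter u (a ++ b) ∨ any (u <ᵇ_) b)
  ≡⟨ sym (∨-assoc (any P (a ++ b)) _ _) ⟩
    (any P (a ++ b) ∨ pairAfter u (a ++ b)) ∨ any (u <ᵇ_) b ∎
  where
  open ≡-Reasoning
  P : ℕ → Bool
  P c = (u <ᵇ c) ∧ (c <ᵇ w)
  skipMax : any P (a ++ x ∷ b) ≡ any P (a ++ b)
  skipMax rewrite any-++ P a (x ∷ b) | any-++ P a b | ≤⇒<ᵇ≡false (<⇒≤ w<x) | ∧-zeroʳ (u <ᵇ x) = refl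

has132-insertMax : ∀ x a b → All (_< x) a → All (_< x) b →
  has132 (a ++ x ∷ b) ≡ has132 (a ++ b) ∨ rises a b
has132-insertMax x [] b _ b<x rewrite pairAfter-below x b b<x = sym (∨-identityʳ _)
has132-insertMax x (u ∷ a) b (_ ∷ a<x) b<x
  rewrite pairAfter-insertMax u x a b a<x b<x | has132-insertMax x a b a<x b<x =
  ∨-interchange (pairAfter u (a ++ b)) _ _ _

pairAfter-appendMin : ∀ {l} u ys → l ≤ u → pairAfter u (ys ++ l ∷ []) ≡ pairAfter u ys
pairAfter-appendMin u [] _ = refl
pairAfter-appendMin {l} u (w ∷ r) l≤u
  rewrite any-++ (λ c → (u <ᵇ c) ∧ (c <ᵇ w)) r (l ∷ []) | ≤⇒<ᵇ≡false l≤u | pairAfter-appendMin u r l≤u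
        | ∨-identityʳ (any (λ c → (u <ᵇ c) ∧ (c <ᵇ w)) r) = refl

has132-appendMin : ∀ ys l → All (l ≤_) ys → has132 (ys ++ l ∷ []) ≡ has132 ys
has132-appendMin [] l _ = refl
has132-appendMin (u ∷ r) l (l≤u ∷ l≤r) rewrite pairAfter-appendMin u r l≤u | has132-appendMin r l l≤r = refl

pairAfter-map-suc : ∀ u σ → pairAfter (suc u) (map suc σ) ≡ pairAfter u σ
pairAfter-map-suc u [] = refl
pairAfter-map-suc u (b ∷ r) rewrite any-map (λ c → (suc u <ᵇ c) ∧ (c <ᵇ suc b)) suc r | pairAfter-map-suc u r = refl

has132-map-suc : ∀ σ → has132 (map suc σ) ≡ has132 σ
has132-map-suc [] = refl
has132-map-suc (a ∷ σ) rewrite pairAfter-map-suc a σ | has132-map-suc σ = refl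

adjPairs-map-suc : ∀ σ → adjPairs (map suc σ) ≡ adjPairs σ
adjPairs-map-suc = shifted nothing
  where
  shifted : ∀ p σ → adjPairsFrom (Maybe.map suc p) (map suc σ) ≡ adjPairsFrom p σ
  shifted p [] = refl
  shifted nothing (a ∷ σ) = shifted (just a) σ
  shifted (just x) (a ∷ σ) = cong (𝟙 (adj x a) +_) (shifted (just a) σ)

lastFrom : Maybe ℕ → List ℕ → Maybe ℕ
lastFrom p [] = p
lastFrom p (x ∷ xs) = lastFrom (just x) xs

lastFrom-∷ʳ : ∀ p ys l → lastFrom p (ys ++ l ∷ []) ≡ just l
lastFrom-∷ʳ p [] l = refl
lastFrom-∷ʳ p (x ∷ ys) l = lastFrom-∷ʳ (just x) ys l

lastIs-∷ʳ : ∀ n ys l → lastIs n (ys ++ l ∷ []) ≡ (l ≡ᵇ n)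
lastIs-∷ʳ n ys l rewrite reverse-++ ys (l ∷ []) = refl

adjPairsFrom-++ : ∀ p u v → adjPairsFrom p (u ++ v) ≡ adjPairsFrom p u + adjPairsFrom (lastFrom p u) v
adjPairsFrom-++ p [] v = refl
adjPairsFrom-++ p (x ∷ u) v =
  trans (cong (𝟙 (adjM p x) +_) (adjPairsFrom-++ (just x) u v)) (sym (+-assoc (𝟙 (adjM p x)) _ _))

adjPairs≤adjPairsFrom : ∀ p v → adjPairs v ≤ adjPairsFrom p v
adjPairs≤adjPairsFrom p [] = z≤n
adjPairs≤adjPairsFrom p (_ ∷ _) = m≤n+m _ _

adjPairs-prefix : ∀ u v → adjPairs u ≤ adjPairs (u ++ v)
adjPairs-prefix u v rewrite adjPairsFrom-++ nothing u v = m≤m+n _ _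

adjPairs-suffix : ∀ u w v → adjPairs v ≤ adjPairs (u ++ w ∷ v)
adjPairs-suffix u w v rewrite adjPairsFrom-++ nothing u (w ∷ v) =
  ≤-trans (adjPairs≤adjPairsFrom (just w) v) (≤-trans (m≤n+m _ _) (m≤n+m _ (adjPairs u)))

adjM-last-suc : ∀ n a → All (_≤ n) a → adjM (lastFrom nothing a) (suc n) ≡ lastIs n a
adjM-last-suc n a a≤n with reverseView a
... | [] = refl
... | ys ∶ _ ∶ʳ l rewrite lastFrom-∷ʳ nothing ys l | lastIs-∷ʳ n ys l =
  adj-suc (lookup (++⁻ʳ ys a≤n) (here refl))

-- Permutations built by inserting maxima

data IsPerm : ℕ → List ℕ → Set where
  [] : IsPerm 0 []
  insertMax : ∀ {n} a b → IsPerm n (a ++ b) → IsPerm (suc n) (a ++ suc n ∷ b)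

splits : List ℕ → List (List ℕ × List ℕ)
splits [] = ([] , []) ∷ []
splits (t ∷ ts) = ([] , t ∷ ts) ∷ map (λ p → (t ∷ proj₁ p , proj₂ p)) (splits ts)

insertAt : ℕ → List ℕ × List ℕ → List ℕ
insertAt x p = proj₁ p ++ x ∷ proj₂ p

insertAll-splits : ∀ x τ → insertAll x τ ≡ map (insertAt x) (splits τ)
insertAll-splits x [] = refl
insertAll-splits x (t ∷ ts) = cong ((x ∷ t ∷ ts) ∷_)
  (trans (cong (map (t ∷_)) (insertAll-splits x ts)) (trans (sym (map-∘ (splits ts))) (map-∘ (splits ts))))

splits-++ : ∀ τ → All (λ p → proj₁ p ++ proj₂ p ≡ τ) (splits τ)
splits-++ [] = refl ∷ []
splits-++ (t ∷ ts) = refl ∷ map⁺ (All.map (cong (t ∷_)) (splits-++ ts))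

perms-IsPerm : ∀ n → All (IsPerm n) (perms n)
perms-IsPerm zero = [] ∷ []
perms-IsPerm (suc n) = concatMap⁺ (perms-IsPerm n)
  where
  concatMap⁺ : ∀ {τs} → All (IsPerm n) τs → All (IsPerm (suc n)) (concatMap (insertAll (suc n)) τs)
  concatMap⁺ [] = []
  concatMap⁺ {τ ∷ _} (p ∷ ps) =
    ++⁺ (subst (All (IsPerm (suc n))) (sym (insertAll-splits (suc n) τ))
          (map⁺ (All.map (λ {s} e → insertMax (proj₁ s) (proj₂ s) (subst (IsPerm n) (sym e) p)) (splits-++ τ))))
        (concatMap⁺ ps)

IsPerm-≤ : ∀ {n τ} → IsPerm n τ → All (_≤ n) τ
IsPerm-≤ [] = []
IsPerm-≤ (insertMax {n} a b p) with ++⁻ a (IsPerm-≤ p)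
... | a≤n , b≤n = ++⁺ (All.map m≤n⇒m≤1+n a≤n) (≤-refl ∷ All.map m≤n⇒m≤1+n b≤n)

IsPerm-length : ∀ {n τ} → IsPerm n τ → length τ ≡ n
IsPerm-length [] = refl
IsPerm-length (insertMax {n} a b p) = begin
    length (a ++ suc n ∷ b)   ≡⟨ length-++ a ⟩
    length a + suc (length b) ≡⟨ +-suc (length a) (length b) ⟩
    suc (length a + length b) ≡⟨ cong suc (sym (length-++ a)) ⟩
    suc (length (a ++ b))     ≡⟨ cong suc (IsPerm-length p) ⟩
    suc n                     ∎
  where open ≡-Reasoning

IsPerm-∋max : ∀ {n τ} → IsPerm n τ → τ ≢ [] → n ∈ τ
IsPerm-∋max [] τ≢[] = ⊥-elim (τ≢[] refl)
IsPerm-∋max (insertMax a b _) _ = ∈-++⁺ʳ a (here refl)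

head≡max : ∀ {n u} b → IsPerm n (u ∷ b) → All (_≤ u) b → u ≡ n
head≡max b p b≤u with IsPerm-∋max p (λ ())
... | here n≡u = sym n≡u
... | there n∈b = ≤-antisym (All.head (IsPerm-≤ p)) (lookup b≤u n∈b)

∷-in-++ : ∀ (c d u v : List ℕ) x → c ++ x ∷ d ≡ u ++ v →
  (Σ (List ℕ) λ u₂ → (u ≡ c ++ x ∷ u₂) × (d ≡ u₂ ++ v)) ⊎
  (Σ (List ℕ) λ v₁ → (c ≡ u ++ v₁) × (v ≡ v₁ ++ x ∷ d))
∷-in-++ c d [] v x e = inj₂ (c , refl , sym e)
∷-in-++ [] d (w ∷ u) v x e with ∷-injective e
... | refl , e′ = inj₁ (u , refl , e′)
∷-in-++ (c₀ ∷ c) d (w ∷ u) v x e with ∷-injective e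
... | refl , e′ with ∷-in-++ c d u v x e′
... | inj₁ (u₂ , u≡ , d≡) = inj₁ (u₂ , cong (c₀ ∷_) u≡ , d≡)
... | inj₂ (v₁ , c≡ , v≡) = inj₂ (v₁ , cong (c₀ ∷_) c≡ , v≡)

self∉below : ∀ {m} u v → All (_< m) (u ++ m ∷ v) → ⊥
self∉below u v u<m = <-irrefl refl (lookup (++⁻ʳ u u<m) (here refl))

maxInUpperPart : ∀ {n τ} → IsPerm n τ → ∀ u a b → τ ≡ (u ∷ a) ++ b → Above (u ∷ a) b → All (_< n) b
maxInUpperPart (insertMax {m} c d p) u a b eq ua≥b with ∷-in-++ c d (u ∷ a) b (suc m) eq | ++⁻ c (IsPerm-≤ p)
... | inj₁ (a₂ , _ , refl) | _ , a₂b≤m = All.map s≤s (++⁻ʳ a₂ a₂b≤m)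
... | inj₂ (v₁ , c≡ , b≡) | c≤m , _ = ⊥-elim (1+n≰n (≤-trans 1+m≤u u≤m))
  where
  1+m≤u : suc m ≤ u
  1+m≤u = lookup (++⁻ʳ v₁ (subst (All (_≤ u)) b≡ (All.head ua≥b))) (here refl)
  u≤m : u ≤ m
  u≤m = All.head (subst (All (_≤ m)) c≡ c≤m)

-- y is a factor whose values form an interval: larger values lie to its left, smaller to its right.
IntervalFactorsHaveAdjPairs : List ℕ → Set
IntervalFactorsHaveAdjPairs τ = ∀ x y z → τ ≡ x ++ y ++ z → Above x (y ++ z) → Above (x ++ y) z →
  2 ≤ length y → 1 ≤ adjPairs y

-- The entries before n+1 form a smaller such factor, or a single entry, which must be n;
-- if there are none, the same holds for the entries after n+1.
intervalFactorThroughMax : ∀ {n} c y z → IsPerm n (c ++ y ++ z) → Above c (y ++ z) → Above (c ++ suc n ∷ y) z →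
  IntervalFactorsHaveAdjPairs (c ++ y ++ z) → 2 ≤ length (c ++ suc n ∷ y) → 1 ≤ adjPairs (c ++ suc n ∷ y)
intervalFactorThroughMax (u₁ ∷ u₂ ∷ c) y z _ c≥yz _ ih _ =
  ≤-trans (ih [] (u₁ ∷ u₂ ∷ c) (y ++ z) refl [] c≥yz (s≤s (s≤s z≤n))) (adjPairs-prefix (u₁ ∷ u₂ ∷ c) _)
intervalFactorThroughMax {n} (u ∷ []) y z p (u≥yz ∷ []) _ _ _
  rewrite head≡max (y ++ z) p u≥yz | adj-n-1+n n = s≤s z≤n
intervalFactorThroughMax {n} [] (v₁ ∷ v₂ ∷ y) z _ _ y≥z ih _ =
  ≤-trans (ih [] (v₁ ∷ v₂ ∷ y) z refl [] (Above-remove [] (suc n) (v₁ ∷ v₂ ∷ y) z y≥z) (s≤s (s≤s z≤n)))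
          (adjPairs-suffix [] (suc n) (v₁ ∷ v₂ ∷ y))
intervalFactorThroughMax {n} [] (v ∷ []) z p _ (_ ∷ v≥z ∷ []) _ _
  rewrite head≡max z p v≥z | adj-sucˡ (≤-refl {n}) | ≡ᵇ-refl n = s≤s z≤n
intervalFactorThroughMax [] [] z _ _ _ _ (s≤s ())

intervalFactors-insertMax : ∀ {n} c d → IsPerm n (c ++ d) → Above c d → IntervalFactorsHaveAdjPairs (c ++ d) →
  IntervalFactorsHaveAdjPairs (c ++ suc n ∷ d)
intervalFactors-insertMax {n} c d p c≥d ih x y z eq x≥yz xy≥z len with ∷-in-++ c d x (y ++ z) (suc n) eq
... | inj₁ (x₂ , refl , refl) =
  ih (c ++ x₂) y z (sym (++-assoc c x₂ (y ++ z))) (Above-remove c (suc n) x₂ (y ++ z) x≥yz)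
     (subst (λ t → Above t z) (sym (++-assoc c x₂ y))
       (Above-remove c (suc n) (x₂ ++ y) z (subst (λ t → Above t z) (++-assoc c (suc n ∷ x₂) y) xy≥z)))
     len
intervalFactors-insertMax {n} c d p _ _ (w ∷ x) y z eq x≥yz _ _ | inj₂ (v₁ , _ , yz≡) =
  ⊥-elim (self∉below v₁ d (subst (All (_< suc n)) yz≡
    (maxInUpperPart (insertMax c d p) w x (y ++ z) eq x≥yz)))
intervalFactors-insertMax {n} c d p c≥d ih [] y z _ _ xy≥z len | inj₂ (_ , refl , yz≡)
  with ∷-in-++ c d y z (suc n) (sym yz≡)
... | inj₁ (y₂ , refl , refl) = intervalFactorThroughMax c y₂ z p c≥d xy≥z ih len
intervalFactors-insertMax {n} c d p _ _ [] (w ∷ y) z eq _ xy≥z _ | inj₂ (_ , refl , _) | inj₂ (v₁ , _ , z≡) =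
  ⊥-elim (self∉below v₁ d (subst (All (_< suc n)) z≡
    (maxInUpperPart (insertMax c d p) w y z eq xy≥z)))

avoider-intervalFactors : ∀ {n τ} → IsPerm n τ → has132 τ ≡ false → IntervalFactorsHaveAdjPairs τ
avoider-intervalFactors [] _ [] [] z _ _ _ ()
avoider-intervalFactors (insertMax {n} c d p) avoids
  with has132-insertMax (suc n) c d (All.map s≤s (++⁻ˡ c (IsPerm-≤ p))) (All.map s≤s (++⁻ʳ c (IsPerm-≤ p)))
... | split with has132 (c ++ d) in avoids′ | rises c d in c↗d
... | false | false =
  intervalFactors-insertMax c d p (rises≡false⇒Above c d c↗d) (avoider-intervalFactors p avoids′)
... | true | _ rewrite split with () ← avoids
... | false | true rewrite split with () ← avoids

-- Good permutations and the recurrences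

good : List ℕ → Bool
good σ = avoids132 σ ∧ (adjPairs σ ≡ᵇ 1)

goodCons goodSnoc : ℕ → List ℕ → Bool
goodCons n τ = avoids132 τ ∧ (adjPairs τ + 𝟙 (firstIs n τ) ≡ᵇ 1)
goodSnoc n τ = avoids132 τ ∧ (adjPairs τ + 𝟙 (lastIs n τ) ≡ᵇ 1)

adjPairs-insertMax : ∀ n a v b → All (_≤ n) a → v ≤ n →
  adjPairs (a ++ suc n ∷ v ∷ b) ≡ adjPairs a + (𝟙 (lastIs n a) + (𝟙 (v ≡ᵇ n) + adjPairs (v ∷ b)))
adjPairs-insertMax n a v b a≤n v≤n
  rewrite adjPairsFrom-++ nothing a (suc n ∷ v ∷ b) | adjM-last-suc n a a≤n | adj-sucˡ v≤n = refl

adjPairs-appendMax : ∀ n a → All (_≤ n) a → adjPairs (a ++ suc n ∷ []) ≡ adjPairs a + 𝟙 (lastIs n a)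
adjPairs-appendMax n a a≤n
  rewrite adjPairsFrom-++ nothing a (suc n ∷ []) | adjM-last-suc n a a≤n = cong (adjPairs a +_) (+-identityʳ _)

good-consMax : ∀ n v b → All (_≤ n) (v ∷ b) → good (suc n ∷ v ∷ b) ≡ goodCons n (v ∷ b)
good-consMax n v b vb≤n = cong₂ (λ h k → not h ∧ (k ≡ᵇ 1))
  (cong (_∨ has132 (v ∷ b)) (pairAfter-below (suc n) (v ∷ b) (All.map s≤s vb≤n)))
  (trans (cong (λ t → 𝟙 t + adjPairsFrom (just v) b) (adj-sucˡ (All.head vb≤n))) (+-comm (𝟙 (v ≡ᵇ n)) _))

good-appendMax : ∀ n a → All (_≤ n) a → good (a ++ suc n ∷ []) ≡ goodSnoc n a
good-appendMax n a a≤n = cong₂ (λ h k → not h ∧ (k ≡ᵇ 1))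
  (trans (has132-insertMax (suc n) a [] (All.map s≤s a≤n) [])
    (trans (cong₂ _∨_ (cong has132 (++-identityʳ a)) (rises-[] a)) (∨-identityʳ _)))
  (adjPairs-appendMax n a a≤n)

good-insertMax-rising : ∀ n a b → All (_≤ n) a → All (_≤ n) b → rises a b ≡ true →
  good (a ++ suc n ∷ b) ≡ false
good-insertMax-rising n a b a≤n b≤n a↗b
  rewrite has132-insertMax (suc n) a b (All.map s≤s a≤n) (All.map s≤s b≤n) | a↗b
        | ∨-comm (has132 (a ++ b)) true = refl

good-insertMax-beforeLast : ∀ n a v → All (_≤ n) a → v < n →
  good (a ++ suc n ∷ v ∷ []) ≡ not (rises a (v ∷ [])) ∧ goodSnoc n a
good-insertMax-beforeLast n a v a≤n v<n with rises a (v ∷ []) in a↗v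
... | true = good-insertMax-rising n a (v ∷ []) a≤n (<⇒≤ v<n ∷ []) a↗v
... | false
  rewrite has132-insertMax (suc n) a (v ∷ []) (All.map s≤s a≤n) (s≤s (<⇒≤ v<n) ∷ []) | a↗v
        | ∨-identityʳ (has132 (a ++ v ∷ []))
        | has132-appendMin a v (All.map (λ { (v≤u ∷ []) → v≤u }) (rises≡false⇒Above a (v ∷ []) a↗v))
        | adjPairs-insertMax n a v [] a≤n (<⇒≤ v<n) | <⇒≡ᵇ≡false v<n | +-identityʳ (𝟙 (lastIs n a)) = refl

upperPart-adjacent : ∀ {n u b} a → IsPerm n ((u ∷ a) ++ b) → has132 ((u ∷ a) ++ b) ≡ false → Above (u ∷ a) b →
  1 ≤ adjPairs (u ∷ a) + 𝟙 (lastIs n (u ∷ a))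
upperPart-adjacent {n} {u} {b} [] p _ (u≥b ∷ []) rewrite head≡max b p u≥b | ≡ᵇ-refl n = s≤s z≤n
upperPart-adjacent {n} {u} {b} (u′ ∷ a) p avoids ua≥b =
  ≤-trans (avoider-intervalFactors p avoids [] (u ∷ u′ ∷ a) b refl [] ua≥b (s≤s (s≤s z≤n))) (m≤m+n _ _)

good-insertMax-interior : ∀ n u a w v b → IsPerm n ((u ∷ a) ++ w ∷ v ∷ b) →
  good ((u ∷ a) ++ suc n ∷ w ∷ v ∷ b) ≡ false
good-insertMax-interior n u a w v b p with ++⁻ (u ∷ a) (IsPerm-≤ p)
... | ua≤n , wvb≤n
  rewrite has132-insertMax (suc n) (u ∷ a) (w ∷ v ∷ b) (All.map s≤s ua≤n) (All.map s≤s wvb≤n)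
  with has132 ((u ∷ a) ++ w ∷ v ∷ b) in avoids | rises (u ∷ a) (w ∷ v ∷ b) in ua↗wvb
... | true | _ = refl
... | false | true = refl
... | false | false rewrite adjPairs-insertMax n (u ∷ a) w (v ∷ b) ua≤n (All.head wvb≤n) = ≥2⇒≢ᵇ1 twoPairs
  where
  ua≥wvb : Above (u ∷ a) (w ∷ v ∷ b)
  ua≥wvb = rises≡false⇒Above _ _ ua↗wvb
  lowerPair : 1 ≤ adjPairs (w ∷ v ∷ b)
  lowerPair = avoider-intervalFactors p avoids (u ∷ a) (w ∷ v ∷ b) []
    (cong ((u ∷ a) ++_) (sym (++-identityʳ _))) (subst (Above (u ∷ a)) (sym (++-identityʳ _)) ua≥wvb)
    (Above-[] _) (s≤s (s≤s z≤n))
  twoPairs : 2 ≤ adjPairs (u ∷ a) + (𝟙 (lastIs n (u ∷ a)) + (𝟙 (w ≡ᵇ n) + adjPairs (w ∷ v ∷ b)))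
  twoPairs = begin
    2                                                          ≤⟨ +-mono-≤ (upperPart-adjacent a p avoids ua≥wvb) lowerPair ⟩
    adjPairs (u ∷ a) + 𝟙 (lastIs n (u ∷ a)) + adjPairs (w ∷ v ∷ b)
      ≡⟨ +-assoc (adjPairs (u ∷ a)) _ _ ⟩
    adjPairs (u ∷ a) + (𝟙 (lastIs n (u ∷ a)) + adjPairs (w ∷ v ∷ b))
      ≤⟨ +-monoʳ-≤ (adjPairs (u ∷ a)) (+-monoʳ-≤ (𝟙 (lastIs n (u ∷ a))) (m≤n+m _ (𝟙 (w ≡ᵇ n)))) ⟩
    adjPairs (u ∷ a) + (𝟙 (lastIs n (u ∷ a)) + (𝟙 (w ≡ᵇ n) + adjPairs (w ∷ v ∷ b))) ∎
    where open ≤-Reasoning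
  ≥2⇒≢ᵇ1 : ∀ {k} → 2 ≤ k → (k ≡ᵇ 1) ≡ false
  ≥2⇒≢ᵇ1 (s≤s (s≤s _)) = refl

isNil : List ℕ → Bool
isNil [] = true
isNil (_ ∷ _) = false

isNil-∷ʳ : ∀ ys l → isNil (ys ++ l ∷ []) ≡ false
isNil-∷ʳ [] l = refl
isNil-∷ʳ (_ ∷ _) l = refl

atSingleton : (List ℕ → ℕ → ℕ) → List ℕ → List ℕ → ℕ
atSingleton f a [] = 0
atSingleton f a (l ∷ []) = f a l
atSingleton f a (_ ∷ _ ∷ _) = 0

belowLast : (List ℕ → ℕ) → List ℕ → ℕ → ℕ
belowLast w a l = 𝟙 (not (rises a (l ∷ []))) * w a

-- The maximum n+1 of a good permutation is first, last, or second to last above a minimal last entry.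
weight-good : ∀ {n} a b → IsPerm n (a ++ b) →
  𝟙 (good (a ++ suc n ∷ b)) ≡ 𝟙 (isNil a) * 𝟙 (goodCons n (a ++ b)) + 𝟙 (isNil b) * 𝟙 (goodSnoc n (a ++ b))
                               + atSingleton (belowLast (λ τ → 𝟙 (goodSnoc n τ))) a b
weight-good [] [] _ = refl
weight-good {n} [] (v ∷ []) p rewrite good-consMax n v [] (IsPerm-≤ p) =
  sym (trans (+-identityʳ _) (trans (+-identityʳ _) (*-identityˡ _)))
weight-good {n} [] (v ∷ w ∷ b) p rewrite good-consMax n v (w ∷ b) (IsPerm-≤ p) =
  sym (trans (+-identityʳ _) (trans (+-identityʳ _) (*-identityˡ _)))
weight-good {n} (u ∷ a) [] p rewrite ++-identityʳ a | good-appendMax n (u ∷ a) (IsPerm-≤ p) =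
  sym (trans (+-identityʳ _) (*-identityˡ _))
weight-good {n} (u ∷ a) (v ∷ []) p with ++⁻ (u ∷ a) (IsPerm-≤ p) | rises (u ∷ a) (v ∷ []) in ua↗v
... | ua≤n , v≤n | true rewrite good-insertMax-rising n (u ∷ a) (v ∷ []) ua≤n v≤n ua↗v = refl
... | ua≤n , _ | false
  rewrite good-insertMax-beforeLast n (u ∷ a) v ua≤n
            (All.head (maxInUpperPart p u a (v ∷ []) refl (rises≡false⇒Above _ _ ua↗v)))
        | ua↗v = 𝟙-∧ true (goodSnoc n (u ∷ a))
weight-good {n} (u ∷ a) (v ∷ w ∷ b) p rewrite good-insertMax-interior n u a v w b p = refl

weight-maxFirst : ∀ {n} a b → IsPerm n (a ++ b) →
  𝟙 (good (a ++ suc n ∷ b) ∧ firstIs (suc n) (a ++ suc n ∷ b)) ≡ 𝟙 (isNil a) * 𝟙 (goodCons n (a ++ b))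
weight-maxFirst [] [] _ = refl
weight-maxFirst {n} [] (v ∷ b) p
  rewrite good-consMax n v b (IsPerm-≤ p) | ≡ᵇ-refl n | ∧-identityʳ (goodCons n (v ∷ b)) = sym (+-identityʳ _)
weight-maxFirst {n} (u ∷ a) b p
  rewrite <⇒≡ᵇ≡false {u} {suc n} (s≤s (All.head (IsPerm-≤ p))) | ∧-zeroʳ (good (u ∷ a ++ suc n ∷ b)) = refl

weight-maxLast : ∀ {n} a b → IsPerm n (a ++ b) →
  𝟙 (good (a ++ suc n ∷ b) ∧ lastIs (suc n) (a ++ suc n ∷ b)) ≡ 𝟙 (isNil b) * 𝟙 (goodSnoc n (a ++ b))
weight-maxLast {n} a b p with reverseView b
... | [] rewrite ++-identityʳ a | good-appendMax n a (IsPerm-≤ p) | lastIs-∷ʳ (suc n) a (suc n) | ≡ᵇ-refl n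
                | ∧-identityʳ (goodSnoc n a) = sym (+-identityʳ _)
... | ys ∶ _ ∶ʳ l rewrite sym (++-assoc a (suc n ∷ ys) (l ∷ [])) | lastIs-∷ʳ (suc n) (a ++ suc n ∷ ys) l
                        | <⇒≡ᵇ≡false (s≤s (lookup (++⁻ʳ ys (++⁻ʳ a (IsPerm-≤ p))) (here refl)))
                        | ∧-zeroʳ (good ((a ++ suc n ∷ ys) ++ l ∷ [])) | isNil-∷ʳ ys l = refl

splitSum : (List ℕ → List ℕ → ℕ) → List ℕ → ℕ
splitSum h τ = sumBy (λ s → h (proj₁ s) (proj₂ s)) (splits τ)

sumBy-splitSum-+ : ∀ (h₁ h₂ : List ℕ → List ℕ → ℕ) τs →
  sumBy (splitSum (λ a b → h₁ a b + h₂ a b)) τs ≡ sumBy (splitSum h₁) τs + sumBy (splitSum h₂) τs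
sumBy-splitSum-+ h₁ h₂ τs = trans (sumBy-cong τs (λ τ → sumBy-+ _ _ (splits τ))) (sumBy-+ _ _ τs)

splitSum-atStart : ∀ (c : List ℕ → ℕ) τ → splitSum (λ a b → 𝟙 (isNil a) * c (a ++ b)) τ ≡ c τ
splitSum-atStart c [] = trans (+-identityʳ _) (*-identityˡ _)
splitSum-atStart c (t ∷ ts) =
  trans (cong₂ _+_ (*-identityˡ _) (trans (sumBy-map _ _ (splits ts)) (sumBy-zero _ (splits ts) (λ _ → refl))))
        (+-identityʳ _)

splitSum-atEnd : ∀ (c : List ℕ → ℕ) τ → splitSum (λ a b → 𝟙 (isNil b) * c (a ++ b)) τ ≡ c τ
splitSum-atEnd c [] = trans (+-identityʳ _) (*-identityˡ _)
splitSum-atEnd c (t ∷ ts) = trans (sumBy-map _ _ (splits ts)) (splitSum-atEnd (λ τ → c (t ∷ τ)) ts)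

splitSum-atSingleton : ∀ f ys l → splitSum (atSingleton f) (ys ++ l ∷ []) ≡ f ys l
splitSum-atSingleton f [] l = +-identityʳ _
splitSum-atSingleton f (y ∷ ys) l =
  trans (cong₂ _+_ (notSingleton ys)
          (trans (sumBy-map _ _ (splits (ys ++ l ∷ []))) (sumBy-cong (splits (ys ++ l ∷ [])) (λ s → shift (proj₂ s)))))
        (splitSum-atSingleton (λ a → f (y ∷ a)) ys l)
  where
  notSingleton : ∀ ys → atSingleton f [] (y ∷ ys ++ l ∷ []) ≡ 0
  notSingleton [] = refl
  notSingleton (_ ∷ _) = refl
  shift : ∀ {a} b → atSingleton f (y ∷ a) b ≡ atSingleton (λ a → f (y ∷ a)) a b
  shift [] = refl
  shift (_ ∷ []) = refl
  shift (_ ∷ _ ∷ _) = refl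

sumBy-perms-suc : ∀ n (w : List ℕ → ℕ) →
  sumBy w (perms (suc n)) ≡ sumBy (splitSum (λ a b → w (a ++ suc n ∷ b))) (perms n)
sumBy-perms-suc n w = trans (sumBy-concatMap w (insertAll (suc n)) (perms n))
  (sumBy-cong (perms n) (λ τ → trans (cong (sumBy w) (insertAll-splits (suc n) τ)) (sumBy-map w _ (splits τ))))

sumBy-perms-suc-by : ∀ n (w : List ℕ → ℕ) (h : List ℕ → List ℕ → ℕ) →
  (∀ a b → IsPerm n (a ++ b) → w (a ++ suc n ∷ b) ≡ h a b) →
  sumBy w (perms (suc n)) ≡ sumBy (splitSum h) (perms n)
sumBy-perms-suc-by n w h w≡h = trans (sumBy-perms-suc n w) (sumBy-cong-All (perms n) (perms-IsPerm n)
  (λ τ p → sumBy-cong-All (splits τ) (splits-++ τ)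
    (λ { (a , b) a++b≡τ → w≡h a b (subst (IsPerm n) (sym a++b≡τ) p) })))

countGood countGoodFirst countGoodLast : ℕ → ℕ
countGood n = sumBy (λ σ → 𝟙 (good σ)) (perms n)
countGoodFirst n = sumBy (λ σ → 𝟙 (good σ ∧ firstIs n σ)) (perms n)
countGoodLast n = sumBy (λ σ → 𝟙 (good σ ∧ lastIs n σ)) (perms n)

countGoodFirst-insert : ∀ n →
  countGoodFirst (suc n) ≡ sumBy (splitSum (λ a b → 𝟙 (isNil a) * 𝟙 (goodCons n (a ++ b)))) (perms n)
countGoodFirst-insert n = sumBy-perms-suc-by n _ _ weight-maxFirst

countGoodLast-insert : ∀ n →
  countGoodLast (suc n) ≡ sumBy (splitSum (λ a b → 𝟙 (isNil b) * 𝟙 (goodSnoc n (a ++ b)))) (perms n)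
countGoodLast-insert n = sumBy-perms-suc-by n _ _ weight-maxLast

countGoodFirst-suc : ∀ n → countGoodFirst (suc n) ≡ sumBy (λ τ → 𝟙 (goodCons n τ)) (perms n)
countGoodFirst-suc n = trans (countGoodFirst-insert n) (sumBy-cong (perms n) (splitSum-atStart _))

countGoodLast-suc : ∀ n → countGoodLast (suc n) ≡ sumBy (λ τ → 𝟙 (goodSnoc n τ)) (perms n)
countGoodLast-suc n = trans (countGoodLast-insert n) (sumBy-cong (perms n) (splitSum-atEnd _))

lastMinWeight : (List ℕ → ℕ) → List ℕ → ℕ
lastMinWeight w = splitSum (atSingleton (belowLast w))

countGood-suc : ∀ n → countGood (suc n) ≡
  countGoodFirst (suc n) + countGoodLast (suc n) + sumBy (lastMinWeight (λ τ → 𝟙 (goodSnoc n τ))) (perms n)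
countGood-suc n = begin
    countGood (suc n)
  ≡⟨ sumBy-perms-suc-by n _ (λ a b → first a b + last a b + middle a b) weight-good ⟩
    sumBy (splitSum (λ a b → first a b + last a b + middle a b)) (perms n)
  ≡⟨ sumBy-splitSum-+ _ middle (perms n) ⟩
    sumBy (splitSum (λ a b → first a b + last a b)) (perms n) + sumBy (splitSum middle) (perms n)
  ≡⟨ cong (_+ sumBy (splitSum middle) (perms n)) (sumBy-splitSum-+ first last (perms n)) ⟩
    sumBy (splitSum first) (perms n) + sumBy (splitSum last) (perms n) + sumBy (splitSum middle) (perms n)
  ≡⟨ cong (_+ sumBy (splitSum middle) (perms n)) (sym (cong₂ _+_ (countGoodFirst-insert n) (countGoodLast-insert n))) ⟩
    countGoodFirst (suc n) + countGoodLast (suc n) + sumBy (splitSum middle) (perms n) ∎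
  where
  open ≡-Reasoning
  first last middle : List ℕ → List ℕ → ℕ
  first a b = 𝟙 (isNil a) * 𝟙 (goodCons n (a ++ b))
  last a b = 𝟙 (isNil b) * 𝟙 (goodSnoc n (a ++ b))
  middle = atSingleton (belowLast (λ τ → 𝟙 (goodSnoc n τ)))

avoider-adjPairs-pos : ∀ {n τ} → IsPerm n τ → 2 ≤ n → has132 τ ≡ false → 1 ≤ adjPairs τ
avoider-adjPairs-pos {n} {τ} p 2≤n avoids = avoider-intervalFactors p avoids [] τ [] (sym (++-identityʳ τ)) [] (Above-[] τ)
  (subst (2 ≤_) (sym (IsPerm-length p)) 2≤n)

-- An avoider of length ≥ 2 has an adjacent pair, so adjPairs τ + 𝟙 flag ≡ 1 means good τ with the flag off.
good-byFlag : ∀ {n τ} flag → IsPerm n τ → 2 ≤ n →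
  𝟙 (avoids132 τ ∧ (adjPairs τ + 𝟙 flag ≡ᵇ 1)) + 𝟙 (good τ ∧ flag) ≡ 𝟙 (good τ)
good-byFlag {n} {τ} flag p 2≤n with has132 τ in contains
... | true = refl
... | false = byFlag (adjPairs τ) flag (avoider-adjPairs-pos p 2≤n contains)
  where
  byFlag : ∀ k flag → 1 ≤ k → 𝟙 (k + 𝟙 flag ≡ᵇ 1) + 𝟙 ((k ≡ᵇ 1) ∧ flag) ≡ 𝟙 (k ≡ᵇ 1)
  byFlag (suc k) true _ rewrite +-comm k 1 = cong 𝟙 (∧-identityʳ _)
  byFlag k false _ rewrite +-identityʳ k | ∧-zeroʳ (k ≡ᵇ 1) = +-identityʳ _

countGood-byFlag : ∀ n (flag : List ℕ → Bool) → 2 ≤ n →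
  sumBy (λ τ → 𝟙 (avoids132 τ ∧ (adjPairs τ + 𝟙 (flag τ) ≡ᵇ 1))) (perms n)
    + sumBy (λ τ → 𝟙 (good τ ∧ flag τ)) (perms n) ≡ countGood n
countGood-byFlag n flag 2≤n = trans (sym (sumBy-+ _ _ (perms n)))
  (sumBy-cong-All (perms n) (perms-IsPerm n) (λ τ p → good-byFlag (flag τ) p 2≤n))

splits-∷ʳ : ∀ ys l → splits (ys ++ l ∷ []) ≡
  map (λ s → (proj₁ s , proj₂ s ++ l ∷ [])) (splits ys) ++ (ys ++ l ∷ [] , []) ∷ []
splits-∷ʳ [] l = refl
splits-∷ʳ (y ∷ ys) l = cong (([] , y ∷ ys ++ l ∷ []) ∷_)
  (trans (cong (map prepend) (splits-∷ʳ ys l))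
  (trans (map-++ prepend (map append (splits ys)) _)
  (cong (_++ (y ∷ ys ++ l ∷ [] , []) ∷ []) (trans (sym (map-∘ (splits ys))) (map-∘ (splits ys))))))
  where
  prepend append : List ℕ × List ℕ → List ℕ × List ℕ
  prepend s = (y ∷ proj₁ s , proj₂ s)
  append s = (proj₁ s , proj₂ s ++ l ∷ [])

rises-insertAbove : ∀ x a b l → l ≤ x → rises (a ++ x ∷ b) (l ∷ []) ≡ rises (a ++ b) (l ∷ [])
rises-insertAbove x a b l l≤x
  rewrite rises-++ˡ a (x ∷ b) (l ∷ []) | rises-++ˡ a b (l ∷ []) | ≤⇒<ᵇ≡false l≤x = refl

lastMinWeight-∷ʳ : ∀ w ys l → lastMinWeight w (ys ++ l ∷ []) ≡ belowLast w ys l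
lastMinWeight-∷ʳ w = splitSum-atSingleton (belowLast w)

-- An entry x above the last entry l leaves l the minimum iff it is inserted before l.
insertAbove-lastMinWeight : ∀ x w ys l → l < x →
  splitSum (λ a b → lastMinWeight w (a ++ x ∷ b)) (ys ++ l ∷ []) ≡
  lastMinWeight (splitSum (λ a b → w (a ++ x ∷ b))) (ys ++ l ∷ [])
insertAbove-lastMinWeight x w ys l l<x = begin
    sumBy weight (splits (ys ++ l ∷ []))
  ≡⟨ cong (sumBy weight) (splits-∷ʳ ys l) ⟩
    sumBy weight (map _ (splits ys) ++ (ys ++ l ∷ [] , []) ∷ [])
  ≡⟨ sumBy-++ weight (map _ (splits ys)) _ ⟩
    sumBy weight (map _ (splits ys)) + (weight (ys ++ l ∷ [] , []) + 0)
  ≡⟨ cong₂ _+_ (sumBy-map weight _ (splits ys)) (trans (+-identityʳ _) afterLast) ⟩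
    splitSum (λ a b → lastMinWeight w (a ++ x ∷ b ++ l ∷ [])) ys + 0
  ≡⟨ +-identityʳ _ ⟩
    splitSum (λ a b → lastMinWeight w (a ++ x ∷ b ++ l ∷ [])) ys
  ≡⟨ sumBy-cong-All (splits ys) (splits-++ ys) (λ { (a , b) a++b≡ys → beforeLast a b a++b≡ys }) ⟩
    splitSum (λ a b → 𝟙 (not (rises ys (l ∷ []))) * w (a ++ x ∷ b)) ys
  ≡⟨ sumBy-* (𝟙 (not (rises ys (l ∷ [])))) (λ s → w (insertAt x s)) (splits ys) ⟩
    belowLast (splitSum (λ a b → w (a ++ x ∷ b))) ys l
  ≡⟨ sym (lastMinWeight-∷ʳ _ ys l) ⟩
    lastMinWeight (splitSum (λ a b → w (a ++ x ∷ b))) (ys ++ l ∷ []) ∎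
  where
  open ≡-Reasoning
  weight : List ℕ × List ℕ → ℕ
  weight s = lastMinWeight w (insertAt x s)
  afterLast : weight (ys ++ l ∷ [] , []) ≡ 0
  afterLast rewrite lastMinWeight-∷ʳ w (ys ++ l ∷ []) x | rises-++ˡ ys (l ∷ []) (x ∷ [])
                  | <⇒<ᵇ≡true l<x | ∨-zeroʳ (rises ys (x ∷ [])) = refl
  beforeLast : ∀ a b → a ++ b ≡ ys →
    lastMinWeight w (a ++ x ∷ b ++ l ∷ []) ≡ 𝟙 (not (rises ys (l ∷ []))) * w (a ++ x ∷ b)
  beforeLast a b refl rewrite sym (++-assoc a (x ∷ b) (l ∷ [])) | lastMinWeight-∷ʳ w (a ++ x ∷ b) l
                            | rises-insertAbove x a b l (<⇒≤ l<x) = refl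

insertMax-lastMinWeight : ∀ {m τ} → IsPerm (suc m) τ → ∀ w →
  splitSum (λ a b → lastMinWeight w (a ++ suc (suc m) ∷ b)) τ ≡
  lastMinWeight (splitSum (λ a b → w (a ++ suc (suc m) ∷ b))) τ
insertMax-lastMinWeight {m} {τ} p w with reverseView τ
... | [] = ⊥-elim (0≢1+n (IsPerm-length p))
... | ys ∶ _ ∶ʳ l = insertAbove-lastMinWeight (suc (suc m)) w ys l (s≤s (lookup (++⁻ʳ ys (IsPerm-≤ p)) (here refl)))

sumBy-lastMinWeight : ∀ n w → sumBy (lastMinWeight w) (perms (suc n)) ≡ sumBy (λ ρ → w (map suc ρ)) (perms n)
sumBy-lastMinWeight zero w = cong (_+ 0) (trans (lastMinWeight-∷ʳ w [] 1) (*-identityˡ _))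
sumBy-lastMinWeight (suc m) w = begin
    sumBy (lastMinWeight w) (perms (suc (suc m)))
  ≡⟨ sumBy-perms-suc (suc m) (lastMinWeight w) ⟩
    sumBy (splitSum (λ a b → lastMinWeight w (a ++ suc (suc m) ∷ b))) (perms (suc m))
  ≡⟨ sumBy-cong-All (perms (suc m)) (perms-IsPerm (suc m)) (λ τ p → insertMax-lastMinWeight p w) ⟩
    sumBy (lastMinWeight w′) (perms (suc m))
  ≡⟨ sumBy-lastMinWeight m w′ ⟩
    sumBy (λ ρ → w′ (map suc ρ)) (perms m)
  ≡⟨ sumBy-cong (perms m) shift ⟩
    sumBy (splitSum (λ a b → w (map suc (a ++ suc m ∷ b)))) (perms m)
  ≡⟨ sym (sumBy-perms-suc m (λ ρ → w (map suc ρ))) ⟩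
    sumBy (λ ρ → w (map suc ρ)) (perms (suc m)) ∎
  where
  open ≡-Reasoning
  w′ : List ℕ → ℕ
  w′ = splitSum (λ a b → w (a ++ suc (suc m) ∷ b))
  splits-map-suc : ∀ ρ → splits (map suc ρ) ≡ map (λ s → (map suc (proj₁ s) , map suc (proj₂ s))) (splits ρ)
  splits-map-suc [] = refl
  splits-map-suc (t ∷ ts) = cong (([] , suc t ∷ map suc ts) ∷_)
    (trans (cong (map _) (splits-map-suc ts)) (trans (sym (map-∘ (splits ts))) (map-∘ (splits ts))))
  shift : ∀ ρ → w′ (map suc ρ) ≡ splitSum (λ a b → w (map suc (a ++ suc m ∷ b))) ρ
  shift ρ = trans (cong (sumBy _) (splits-map-suc ρ)) (trans (sumBy-map _ _ (splits ρ))
    (sumBy-cong (splits ρ) (λ s → cong w (sym (map-++ suc (proj₁ s) (suc m ∷ proj₂ s))))))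

goodSnoc-map-suc : ∀ n ρ → goodSnoc (suc n) (map suc ρ) ≡ goodSnoc n ρ
goodSnoc-map-suc n ρ rewrite has132-map-suc ρ | adjPairs-map-suc ρ | sym (reverse-map suc ρ) =
  cong (λ t → not (has132 ρ) ∧ (adjPairs ρ + 𝟙 t ≡ᵇ 1)) (firstIs-map-suc (reverse ρ))
  where
  firstIs-map-suc : ∀ r → firstIs (suc n) (map suc r) ≡ firstIs n r
  firstIs-map-suc [] = refl
  firstIs-map-suc (_ ∷ _) = refl

-- Deleting the final 1 from a good σ ∈ S(n+2) ending in n+2, 1 leaves a good σ′ ∈ S(n+1) ending in n+1.
middleTerm : ∀ n → sumBy (lastMinWeight (λ τ → 𝟙 (goodSnoc (suc n) τ))) (perms (suc n)) ≡ countGoodLast (suc n)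
middleTerm n = trans (sumBy-lastMinWeight n _)
  (trans (sumBy-cong (perms n) (λ ρ → cong 𝟙 (goodSnoc-map-suc n ρ))) (sym (countGoodLast-suc n)))

counts-Fibonacci : ∀ k →
  (countGood (2 + k) ≡ F (2 + k)) × (countGoodFirst (2 + k) ≡ F k) × (countGoodLast (2 + k) ≡ F k)
counts-Fibonacci zero = refl , refl , refl
counts-Fibonacci (suc k) with counts-Fibonacci k
... | a≡ , b≡ , e≡ = a′≡ , b′≡ , e′≡
  where
  2≤2+k : 2 ≤ 2 + k
  2≤2+k = s≤s (s≤s z≤n)
  b′≡ : countGoodFirst (3 + k) ≡ F (suc k)
  b′≡ = +-cancelʳ-≡ (F k) _ _ (begin
    countGoodFirst (3 + k) + F k      ≡⟨ cong₂ _+_ (countGoodFirst-suc (2 + k)) (sym b≡) ⟩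
    _                                 ≡⟨ countGood-byFlag (2 + k) (firstIs (2 + k)) 2≤2+k ⟩
    countGood (2 + k)                 ≡⟨ a≡ ⟩
    F (suc k) + F k                   ∎)
    where open ≡-Reasoning
  e′≡ : countGoodLast (3 + k) ≡ F (suc k)
  e′≡ = +-cancelʳ-≡ (F k) _ _ (begin
    countGoodLast (3 + k) + F k       ≡⟨ cong₂ _+_ (countGoodLast-suc (2 + k)) (sym e≡) ⟩
    _                                 ≡⟨ countGood-byFlag (2 + k) (lastIs (2 + k)) 2≤2+k ⟩
    countGood (2 + k)                 ≡⟨ a≡ ⟩
    F (suc k) + F k                   ∎)
    where open ≡-Reasoning
  a′≡ : countGood (3 + k) ≡ F (3 + k)
  a′≡ = begin
    countGood (3 + k)                                         ≡⟨ countGood-suc (2 + k) ⟩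
    countGoodFirst (3 + k) + countGoodLast (3 + k) + _        ≡⟨ cong₂ _+_ (cong₂ _+_ b′≡ e′≡) (trans (middleTerm (suc k)) e≡) ⟩
    F (suc k) + F (suc k) + F k                               ≡⟨ +-assoc (F (suc k)) (F (suc k)) (F k) ⟩
    F (suc k) + F (2 + k)                                     ≡⟨ +-comm (F (suc k)) (F (2 + k)) ⟩
    F (3 + k)                                                 ∎
    where open ≡-Reasoning

coeff-⊕ : ∀ p q m → coeff (p ⊕ q) m ≡ coeff p m + coeff q m
coeff-⊕ [] q m = refl
coeff-⊕ (a ∷ p) [] m = sym (+-identityʳ _)
coeff-⊕ (a ∷ p) (b ∷ q) zero = refl
coeff-⊕ (a ∷ p) (b ∷ q) (suc m) = coeff-⊕ p q m

coeff-xPow : ∀ k m → coeff (xPow k) m ≡ 𝟙 (k ≡ᵇ m)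
coeff-xPow zero zero = refl
coeff-xPow zero (suc m) = refl
coeff-xPow (suc k) zero = refl
coeff-xPow (suc k) (suc m) = coeff-xPow k m

coeff-boxPoly : ∀ L m → coeff (boxPoly L) m ≡ sumBy (λ σ → 𝟙 (box σ ≡ᵇ m)) L
coeff-boxPoly [] m = refl
coeff-boxPoly (σ ∷ L) m = trans (coeff-⊕ (xPow (box σ)) (boxPoly L) m)
  (cong₂ _+_ (coeff-xPow (box σ) m) (coeff-boxPoly L m))

𝟙-box≡2 : ∀ σ → 𝟙 (avoids132 σ) * 𝟙 (box σ ≡ᵇ 2) ≡ 𝟙 (good σ)
𝟙-box≡2 σ rewrite box≡ᵇ2 σ = sym (𝟙-∧ (avoids132 σ) (adjPairs σ ≡ᵇ 1))

coeff-A : ∀ n → coeff (A n) 2 ≡ countGood n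
coeff-A n = begin
    coeff (A n) 2                                              ≡⟨ coeff-boxPoly (S132 n) 2 ⟩
    sumBy (λ σ → 𝟙 (box σ ≡ᵇ 2)) (S132 n)                      ≡⟨ sumBy-filter avoids132 _ (perms n) ⟩
    sumBy (λ σ → 𝟙 (avoids132 σ) * 𝟙 (box σ ≡ᵇ 2)) (perms n)   ≡⟨ sumBy-cong (perms n) 𝟙-box≡2 ⟩
    countGood n                                                ∎
  where open ≡-Reasoning

coeff-filter-S132 : ∀ n (P : List ℕ → Bool) →
  coeff (boxPoly (filter (λ σ → T? (P σ)) (S132 n))) 2 ≡ sumBy (λ σ → 𝟙 (good σ ∧ P σ)) (perms n)
coeff-filter-S132 n P = begin
    coeff (boxPoly (filter (λ σ → T? (P σ)) (S132 n))) 2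
  ≡⟨ coeff-boxPoly (filter (λ σ → T? (P σ)) (S132 n)) 2 ⟩
    sumBy (λ σ → 𝟙 (box σ ≡ᵇ 2)) (filter (λ σ → T? (P σ)) (S132 n))
  ≡⟨ sumBy-filter P _ (S132 n) ⟩
    sumBy (λ σ → 𝟙 (P σ) * 𝟙 (box σ ≡ᵇ 2)) (S132 n)
  ≡⟨ sumBy-filter avoids132 _ (perms n) ⟩
    sumBy (λ σ → 𝟙 (avoids132 σ) * (𝟙 (P σ) * 𝟙 (box σ ≡ᵇ 2))) (perms n)
  ≡⟨ sumBy-cong (perms n) (λ σ → trans (*-left-comm (𝟙 (avoids132 σ)) (𝟙 (P σ)) _)
                                   (trans (cong (𝟙 (P σ) *_) (𝟙-box≡2 σ)) (*-comm (𝟙 (P σ)) (𝟙 (good σ))))) ⟩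
    sumBy (λ σ → 𝟙 (good σ) * 𝟙 (P σ)) (perms n)
  ≡⟨ sumBy-cong (perms n) (λ σ → sym (𝟙-∧ (good σ) (P σ))) ⟩
    sumBy (λ σ → 𝟙 (good σ ∧ P σ)) (perms n) ∎
  where open ≡-Reasoning

theorem3 : (n : ℕ) → 2 ≤ n →
    (coeff (A n) 2 ≡ F n) × (coeff (B n) 2 ≡ F (n ∸ 2)) × (coeff (E n) 2 ≡ F (n ∸ 2))
theorem3 (suc (suc k)) (s≤s (s≤s z≤n)) with counts-Fibonacci k
... | a≡ , b≡ , e≡ =
  trans (coeff-A (2 + k)) a≡ , trans (coeff-filter-S132 (2 + k) _) b≡ , trans (coeff-filter-S132 (2 + k) _) e≡
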